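{- For all integers $p,p',q,q'\geq 3$, there is a contraction model of $W_{p,q}$ in $W_{p',q'}$ if and only if $(p,q)=(p',q')$.
   Context: Graphs are finite, simple. For $p,q\in\mathbb{N}$, $W_{p,q}$ is the graph obtained from the disjoint union of the edgeless graph $\overline{K}_p$ on $p$ vertices and the complete bipartite graph $K_{2,q}$ by adding two new non-adjacent vertices, each adjacent to every vertex of that disjoint union. A contraction model of $H$ in $G$ is a map $\varphi\colon V(H)\to 2^{V(G)}$ such that each $\varphi(v)$ induces a connected subgraph, $\{\varphi(v)\}$ partitions $V(G)$, and $u,v$ are adjacent in $H$ iff some vertex of $\varphi(u)$ is adjacent to some vertex of $\varphi(v)$. -}

module Defs where

open import Data.Nat using (ℕ)
open import Data.Fin using (Fin)
open import Data.Empty using (⊥)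
open import Data.Unit using (⊤)
open import Data.Product using (Σ; ∃; ∃-syntax; _×_; _,_)
open import Relation.Binary.PropositionalEquality using (_≡_)
open import Relation.Nullary using (¬_)
open import Function.Bundles using (_⇔_)

data WalkIn {V : Set} (E : V → V → Set) (S : V → Set) : V → V → Set where
  here : ∀ {x} → S x → WalkIn E S x x
  step : ∀ {x y z} → S x → E x y → WalkIn E S y z → WalkIn E S x z

Connected : {V : Set} (E : V → V → Set) (S : V → Set) → Set
Connected {V} E S = (∃[ x ] S x) × (∀ x y → S x → S y → WalkIn E S x y)

record ContractionModel (VH : Set) (EH : VH → VH → Set)
                        (VG : Set) (EG : VG → VG → Set) : Set₁ where
  field
    φ         : VH → VG → Set
    connected : ∀ v → Connected EG (φ v)
    -- {φ v} partitions V(G): every vertex of G lies in exactly one branch set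
    -- (blocks are nonempty by `connected`)
    cover     : ∀ x → ∃[ v ] φ v x
    disjoint  : ∀ x u v → φ u x → φ v x → u ≡ v
    adjacency : ∀ u v → ¬ (u ≡ v) →
                (EH u v ⇔ (∃[ x ] ∃[ y ] (φ u x × φ v y × EG x y)))

data WV (p q : ℕ) : Set where
  iso  : Fin p → WV p q   -- vertices of the edgeless graph K̄_p
  side : Fin 2 → WV p q   -- the 2-side of K_{2,q}
  big  : Fin q → WV p q   -- the q-side of K_{2,q}
  apex : Fin 2 → WV p q   -- the two new (non-adjacent) vertices

WE : (p q : ℕ) → WV p q → WV p q → Set
WE p q (side _) (big _)  = ⊤
WE p q (big _)  (side _) = ⊤
WE p q (apex _) (iso _)  = ⊤
WE p q (apex _) (side _) = ⊤
WE p q (apex _) (big _)  = ⊤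
WE p q (iso _)  (apex _) = ⊤
WE p q (side _) (apex _) = ⊤
WE p q (big _)  (apex _) = ⊤
WE p q _        _        = ⊥

HasContractionModelW : (p q p' q' : ℕ) → Set₁
HasContractionModelW p q p' q' = ContractionModel (WV p q) (WE p q) (WV p' q') (WE p' q')

-- Take the branch map c : V(W_{p',q'}) → V(W_{p,q}), x ↦ the branch set containing x.
-- The branch of an apex of W_{p',q'} is adjacent to every vertex outside the two apex
-- branches; in W_{p,q} only an apex has so few non-neighbours, so the two apexes of
-- W_{p',q'} land on the two apexes of W_{p,q}, and then no other vertex can. Hence every
-- edge of W_{p',q'} joins vertices of different branches (for side–big edges because a
-- merged side–big branch would dominate the whole K_{2,q}), so all branch sets are
-- singletons and c is a bijection. It maps isolated vertices (those whose neighbours are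
-- all apexes) onto isolated vertices, so p = p' and, counting all vertices, q = q'.
module Submission where

open import Defs
open import Data.Nat using (ℕ; _+_; _≤_; _≥_; s≤s; z≤n)
open import Data.Nat.Properties using (≤-antisym; ≤-trans; <⇒≤; +-cancelˡ-≡; +-cancelʳ-≡)
open import Data.Fin as Fin using (Fin; zero; suc; fromℕ<)
open import Data.Fin.Properties using (injective⇒≤; +↔⊎; inj⇒≟)
open import Data.Fin.Permutation using (↔⇒≡)
open import Data.Product using (_×_; _,_; proj₁; proj₂; ∃; ∃₂)
open import Data.Sum using (_⊎_; inj₁; inj₂; [_,_])
open import Data.Sum.Function.Propositional using (_⊎-cong_)
open import Data.Empty using (⊥; ⊥-elim)
open import Data.Unit using (tt)
open import Function using (_∘_)
open import Function.Bundles using (_⇔_; _↔_; mk⇔; mk↔ₛ′; Equivalence)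
open import Function.Definitions using (Injective)
open import Function.Properties.Inverse using (↔-sym; ↔-trans; ↔⇒↣)
open import Relation.Binary.Definitions using (DecidableEquality)
open import Relation.Binary.PropositionalEquality
  using (_≡_; _≢_; refl; sym; trans; cong; subst; ≢-sym)
open import Relation.Nullary using (¬_; yes; no)

private variable
  m n p q p' q' : ℕ

distinct⇒one-differs : {A : Set} → DecidableEquality A →
                       ∀ {a b} → a ≢ b → ∀ h → a ≢ h ⊎ b ≢ h
distinct⇒one-differs _≟_ {a} a≢b h with a ≟ h
... | no a≢h   = inj₁ a≢h
... | yes refl = inj₂ (≢-sym a≢b)

two-distinct : 2 ≤ n → ∃₂ λ (i j : Fin n) → i ≢ j
two-distinct (s≤s (s≤s _)) = zero , suc zero , λ ()

injective-into-image⇒≤ : {B : Set} {g : Fin m → B} {κ : Fin n → B} →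
                         Injective _≡_ _≡_ g → (∀ i → ∃ λ j → g i ≡ κ j) → m ≤ n
injective-into-image⇒≤ {κ = κ} g-inj index = injective⇒≤ {f = proj₁ ∘ index} λ {i} {i'} j≡j' →
  g-inj (trans (proj₂ (index i)) (trans (cong κ j≡j') (sym (proj₂ (index i')))))

module ContractionModelProperties
  {VH : Set} {EH : VH → VH → Set} {VG : Set} {EG : VG → VG → Set}
  (M : ContractionModel VH EH VG EG) where

  open ContractionModel M

  branch : VG → VH
  branch x = proj₁ (cover x)

  ∈-branch : ∀ x → φ (branch x) x
  ∈-branch x = proj₂ (cover x)

  branch-unique : ∀ {v x} → φ v x → branch x ≡ v
  branch-unique {v} {x} = disjoint x (branch x) v (∈-branch x)

  representative : VH → VG
  representative v = proj₁ (proj₁ (connected v))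

  branch-representative : ∀ v → branch (representative v) ≡ v
  branch-representative v = branch-unique (proj₂ (proj₁ (connected v)))

  representative-injective : Injective _≡_ _≡_ representative
  representative-injective {u} {v} e =
    trans (sym (branch-representative u)) (trans (cong branch e) (branch-representative v))

  edge⇒branch-edge : ∀ {x y u v} → EG x y → branch x ≡ u → branch y ≡ v → u ≢ v → EH u v
  edge⇒branch-edge {x} {y} xy refl refl u≢v =
    Equivalence.from (adjacency _ _ u≢v) (x , y , ∈-branch x , ∈-branch y , xy)

  branch-edge⇒edge : ∀ {u v} → u ≢ v → EH u v →
                     ∃₂ λ x y → branch x ≡ u × branch y ≡ v × EG x y
  branch-edge⇒edge {u} {v} u≢v uv with Equivalence.to (adjacency u v u≢v) uv
  ... | x , y , x∈u , y∈v , xy = x , y , branch-unique x∈u , branch-unique y∈v , xy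

  -- A walk inside the branch set of x has to leave x along an edge of that branch set.
  branch-singleton : ∀ {x} → (∀ {y} → EG x y → branch x ≢ branch y) →
                     ∀ {z} → branch x ≡ branch z → x ≡ z
  branch-singleton {x} separated {z} x~z =
    trivial (proj₂ (connected (branch x)) x z (∈-branch x) (subst (λ v → φ v z) (sym x~z) (∈-branch z)))
    where
    source : ∀ {y z} → WalkIn EG (φ (branch x)) y z → φ (branch x) y
    source (here s)     = s
    source (step s _ _) = s

    trivial : ∀ {z} → WalkIn EG (φ (branch x)) x z → x ≡ z
    trivial (here _)      = refl
    trivial (step _ xy w) = ⊥-elim (separated xy (sym (branch-unique (source w))))

  branch-injective⇒↔ : Injective _≡_ _≡_ branch → VG ↔ VH
  branch-injective⇒↔ inj = mk↔ₛ′ branch representative branch-representative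
    (λ x → inj (branch-representative (branch x)))

WV↔⊎ : WV p q ↔ ((Fin p ⊎ Fin q) ⊎ (Fin 2 ⊎ Fin 2))
WV↔⊎ = mk↔ₛ′ to from to-from from-to
  where
  to : WV p q → (Fin p ⊎ Fin q) ⊎ (Fin 2 ⊎ Fin 2)
  to (iso k)  = inj₁ (inj₁ k)
  to (big b)  = inj₁ (inj₂ b)
  to (side a) = inj₂ (inj₁ a)
  to (apex i) = inj₂ (inj₂ i)

  from : (Fin p ⊎ Fin q) ⊎ (Fin 2 ⊎ Fin 2) → WV p q
  from (inj₁ (inj₁ k)) = iso k
  from (inj₁ (inj₂ b)) = big b
  from (inj₂ (inj₁ a)) = side a
  from (inj₂ (inj₂ i)) = apex i

  to-from : ∀ u → to (from u) ≡ u
  to-from (inj₁ (inj₁ _)) = refl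
  to-from (inj₁ (inj₂ _)) = refl
  to-from (inj₂ (inj₁ _)) = refl
  to-from (inj₂ (inj₂ _)) = refl

  from-to : ∀ x → from (to x) ≡ x
  from-to (iso _)  = refl
  from-to (big _)  = refl
  from-to (side _) = refl
  from-to (apex _) = refl

WV↔Fin : WV p q ↔ Fin ((p + q) + (2 + 2))
WV↔Fin = ↔-trans WV↔⊎ (↔-sym (↔-trans +↔⊎ (+↔⊎ ⊎-cong +↔⊎)))

_≟_ : DecidableEquality (WV p q)
_≟_ = inj⇒≟ (↔⇒↣ WV↔Fin)

Apex : WV p q → Set
Apex x = ∃ λ i → x ≡ apex i

data Biclique {p q : ℕ} : WV p q → Set where
  side : ∀ a → Biclique (side a)
  big  : ∀ b → Biclique (big b)

iso-injective : ∀ {i j : Fin p} → iso {q = q} i ≡ iso j → i ≡ j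
iso-injective refl = refl

WE-irreflexive : ∀ {x} → ¬ WE p q x x
WE-irreflexive {x = iso _}  ()
WE-irreflexive {x = side _} ()
WE-irreflexive {x = big _}  ()
WE-irreflexive {x = apex _} ()

apex-adjacent : ∀ {x} → ¬ Apex x → ∀ i → WE p q (apex i) x
apex-adjacent {x = iso _}  _ _ = tt
apex-adjacent {x = side _} _ _ = tt
apex-adjacent {x = big _}  _ _ = tt
apex-adjacent {x = apex j} x-non-apex _ = ⊥-elim (x-non-apex (j , refl))

adjacent-apex : ∀ {x} → ¬ Apex x → ∀ i → WE p q x (apex i)
adjacent-apex {x = iso _}  _ _ = tt
adjacent-apex {x = side _} _ _ = tt
adjacent-apex {x = big _}  _ _ = tt
adjacent-apex {x = apex j} x-non-apex _ = ⊥-elim (x-non-apex (j , refl))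

apex-apex-nonadjacent : ∀ {x y} → Apex x → Apex y → ¬ WE p q x y
apex-apex-nonadjacent (_ , refl) (_ , refl) ()

apex-neighbour-non-apex : ∀ {i y} → WE p q (apex i) y → ¬ Apex y
apex-neighbour-non-apex xy y-apex = apex-apex-nonadjacent (_ , refl) y-apex xy

iso-neighbour-apex : ∀ {k y} → WE p q (iso k) y → Apex y
iso-neighbour-apex {y = apex i} _ = i , refl
iso-neighbour-apex {y = iso _}  ()
iso-neighbour-apex {y = side _} ()
iso-neighbour-apex {y = big _}  ()

iso-non-apex : ∀ {k : Fin p} → ¬ Apex (iso {q = q} k)
iso-non-apex (_ , ())

biclique-non-apex : ∀ {x : WV p q} → Biclique x → ¬ Apex x
biclique-non-apex (side _) (_ , ())
biclique-non-apex (big _)  (_ , ())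

iso-non-biclique : ∀ {k : Fin p} → ¬ Biclique (iso {q = q} k)
iso-non-biclique ()

apex-not-dominating : ∀ {h} → Apex h → ¬ (∀ v → v ≢ h → WE p q h v)
apex-not-dominating (zero , refl)     dominates = dominates (apex (suc zero)) λ ()
apex-not-dominating (suc zero , refl) dominates = dominates (apex zero) λ ()

two-non-neighbours⇒¬dominates : ∀ {h h' u v} → u ≢ v → u ≢ h → v ≢ h →
                                ¬ WE p q h u → ¬ WE p q h v →
                                ¬ (∀ w → w ≢ h → w ≢ h' → WE p q h w)
two-non-neighbours⇒¬dominates {h' = h'} u≢v u≢h v≢h ¬hu ¬hv dominates =
  [ ¬hu ∘ dominates _ u≢h , ¬hv ∘ dominates _ v≢h ] (distinct⇒one-differs _≟_ u≢v h')

dominates-all-but-one⇒apex : 2 ≤ p → ∀ {h h'} → (∀ v → v ≢ h → v ≢ h' → WE p q h v) → Apex h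
dominates-all-but-one⇒apex _ {apex i} _ = i , refl
dominates-all-but-one⇒apex _ {iso _} dominates = ⊥-elim
  (two-non-neighbours⇒¬dominates {u = side zero} {side (suc zero)}
    (λ ()) (λ ()) (λ ()) (λ ()) (λ ()) dominates)
dominates-all-but-one⇒apex 2≤p {side _} dominates with two-distinct 2≤p
... | i , j , i≢j = ⊥-elim
  (two-non-neighbours⇒¬dominates {u = iso i} {iso j}
    (i≢j ∘ iso-injective) (λ ()) (λ ()) (λ ()) (λ ()) dominates)
dominates-all-but-one⇒apex 2≤p {big _} dominates with two-distinct 2≤p
... | i , j , i≢j = ⊥-elim
  (two-non-neighbours⇒¬dominates {u = iso i} {iso j}
    (i≢j ∘ iso-injective) (λ ()) (λ ()) (λ ()) (λ ()) dominates)

dominates-biclique⇒apex : 2 ≤ q → ∀ {h} → (∀ v → Biclique v → v ≢ h → WE p q h v) → Apex h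
dominates-biclique⇒apex _ {apex i}          _ = i , refl
dominates-biclique⇒apex _ {iso _}           dominates = ⊥-elim (dominates (side zero) (side _) λ ())
dominates-biclique⇒apex _ {side zero}       dominates = ⊥-elim (dominates (side (suc zero)) (side _) λ ())
dominates-biclique⇒apex _ {side (suc zero)} dominates = ⊥-elim (dominates (side zero) (side _) λ ())
dominates-biclique⇒apex 2≤q {big b} dominates with two-distinct 2≤q
... | i , j , i≢j = ⊥-elim
  ([ (λ i≢b → dominates (big i) (big i) λ { refl → i≢b refl })
  , (λ j≢b → dominates (big j) (big j) λ { refl → j≢b refl })
  ] (distinct⇒one-differs Fin._≟_ i≢j b))

only-apex-neighbours⇒iso : 1 ≤ q → ∀ {v} → (∀ {w} → WE p q v w → Apex w) → ∃ λ k → v ≡ iso k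
only-apex-neighbours⇒iso _   {iso k}  _ = k , refl
only-apex-neighbours⇒iso 1≤q {side _} apex-only =
  ⊥-elim (biclique-non-apex (big (fromℕ< 1≤q)) (apex-only tt))
only-apex-neighbours⇒iso _   {big _}  apex-only = ⊥-elim (biclique-non-apex (side zero) (apex-only tt))
only-apex-neighbours⇒iso _   {apex _} apex-only = ⊥-elim (biclique-non-apex (side zero) (apex-only tt))

module ContractionModelW (2≤p : 2 ≤ p) (2≤q : 2 ≤ q) (1≤q' : 1 ≤ q')
                         (M : HasContractionModelW p q p' q') where

  open ContractionModel M
  open ContractionModelProperties M

  apex-branch-adjacent : ∀ i v → (∀ j → v ≢ branch (apex j)) → WE p q (branch (apex i)) v
  apex-branch-adjacent i v v∉apex-branches = edge⇒branch-edge
    (apex-adjacent rep-non-apex i) refl (branch-representative v) (≢-sym (v∉apex-branches i))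
    where
    rep-non-apex : ¬ Apex (representative v)
    rep-non-apex (j , e) = v∉apex-branches j (trans (sym (branch-representative v)) (cong branch e))

  apex-branch-apex : ∀ i → Apex (branch (apex i))
  apex-branch-apex zero = dominates-all-but-one⇒apex 2≤p λ v v≢a₀ v≢a₁ →
    apex-branch-adjacent zero v λ { zero → v≢a₀ ; (suc zero) → v≢a₁ }
  apex-branch-apex (suc zero) = dominates-all-but-one⇒apex 2≤p λ v v≢a₁ v≢a₀ →
    apex-branch-adjacent (suc zero) v λ { zero → v≢a₀ ; (suc zero) → v≢a₁ }

  apex-branches-distinct : branch (apex zero) ≢ branch (apex (suc zero))
  apex-branches-distinct a₀≡a₁ = apex-not-dominating (apex-branch-apex zero) λ v v≢a₀ →
    apex-branch-adjacent zero v λ { zero → v≢a₀ ; (suc zero) v≡a₁ → v≢a₀ (trans v≡a₁ (sym a₀≡a₁)) }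

  branch-preserves-apex : ∀ {x} → Apex x → Apex (branch x)
  branch-preserves-apex (i , refl) = apex-branch-apex i

  branch-preserves-non-apex : ∀ {x} → ¬ Apex x → ¬ Apex (branch x)
  branch-preserves-non-apex {x} x-non-apex (k , x↦apex) =
    [ apex-adjacent-branch zero , apex-adjacent-branch (suc zero) ]
      (distinct⇒one-differs _≟_ apex-branches-distinct (apex k))
    where
    apex-adjacent-branch : ∀ i → branch (apex i) ≢ apex k → ⊥
    apex-adjacent-branch i aᵢ≢ = apex-apex-nonadjacent (k , refl) (apex-branch-apex i)
      (edge⇒branch-edge (adjacent-apex x-non-apex i) x↦apex refl (≢-sym aᵢ≢))

  branch-reflects-apex : ∀ {x} → Apex (branch x) → Apex x
  branch-reflects-apex {apex i} _ = i , refl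
  branch-reflects-apex {iso _}  = ⊥-elim ∘ branch-preserves-non-apex iso-non-apex
  branch-reflects-apex {side a} = ⊥-elim ∘ branch-preserves-non-apex (biclique-non-apex (side a))
  branch-reflects-apex {big b}  = ⊥-elim ∘ branch-preserves-non-apex (biclique-non-apex (big b))

  apex-separated : ∀ {x y} → Apex x → ¬ Apex y → branch x ≢ branch y
  apex-separated x-apex y-non-apex x~y =
    branch-preserves-non-apex y-non-apex (subst Apex x~y (branch-preserves-apex x-apex))

  iso-branch-singleton : ∀ k {z} → branch (iso k) ≡ branch z → iso k ≡ z
  iso-branch-singleton k = branch-singleton λ ky →
    ≢-sym (apex-separated (iso-neighbour-apex ky) iso-non-apex)

  iso-branch-iso : ∀ k → ∃ λ j → branch (iso k) ≡ iso j
  iso-branch-iso k = only-apex-neighbours⇒iso (<⇒≤ 2≤q) neighbour-apex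
    where
    neighbour-apex : ∀ {w} → WE p q (branch (iso k)) w → Apex w
    neighbour-apex {w} e with branch-edge⇒edge (λ { refl → WE-irreflexive e }) e
    ... | x , y , x↦ , y↦ , xy with iso-branch-singleton k (sym x↦)
    ... | refl = subst Apex y↦ (branch-preserves-apex (iso-neighbour-apex xy))

  representative-biclique : ∀ {v} → Biclique v → Biclique (representative v)
  representative-biclique {v} v-biclique with representative v | branch-representative v
  ... | side a | _ = side a
  ... | big b  | _ = big b
  ... | apex i | e = ⊥-elim (biclique-non-apex v-biclique (subst Apex e (apex-branch-apex i)))
  ... | iso k  | e with iso-branch-iso k
  ...   | j , k↦j = ⊥-elim (iso-non-biclique (subst Biclique (trans (sym e) k↦j) v-biclique))

  side-big-separated : ∀ a b → branch (side a) ≢ branch (big b)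
  side-big-separated a b side~big =
    branch-preserves-non-apex (biclique-non-apex (side a)) (dominates-biclique⇒apex 2≤q dominates)
    where
    dominates : ∀ v → Biclique v → v ≢ branch (side a) → WE p q (branch (side a)) v
    dominates v v-biclique v≢X
      with representative v | branch-representative v | representative-biclique v-biclique
    ... | side a' | e | _ = edge⇒branch-edge {big b} {side a'} tt (sym side~big) e (≢-sym v≢X)
    ... | big b'  | e | _ = edge⇒branch-edge {side a} {big b'} tt refl e (≢-sym v≢X)

  edge-separated : ∀ {x y} → WE p' q' x y → branch x ≢ branch y
  edge-separated {apex i} {y}      xy = apex-separated (i , refl) (apex-neighbour-non-apex xy)
  edge-separated {x}      {apex i} xy =
    ≢-sym (apex-separated (i , refl) λ x-apex → apex-apex-nonadjacent x-apex (i , refl) xy)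
  edge-separated {side a} {big b}  _  = side-big-separated a b
  edge-separated {big b}  {side a} _  = ≢-sym (side-big-separated a b)
  edge-separated {iso _}  {iso _}  ()
  edge-separated {iso _}  {side _} ()
  edge-separated {iso _}  {big _}  ()
  edge-separated {side _} {iso _}  ()
  edge-separated {side _} {side _} ()
  edge-separated {big _}  {iso _}  ()
  edge-separated {big _}  {big _}  ()

  branch-injective : Injective _≡_ _≡_ branch
  branch-injective = branch-singleton edge-separated

  representative-iso : ∀ j → ∃ λ k → representative (iso j) ≡ iso k
  representative-iso j = only-apex-neighbours⇒iso 1≤q' λ {y} xy →
    branch-reflects-apex (iso-neighbour-apex
      (edge⇒branch-edge xy (branch-representative (iso j)) refl
        (edge-separated xy ∘ trans (branch-representative (iso j)))))

  same-parameters : p ≡ p' × q ≡ q'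
  same-parameters = p≡p' , +-cancelˡ-≡ p' q q' (sym (trans vertex-count (cong (_+ q) p≡p')))
    where
    p≡p' : p ≡ p'
    p≡p' = ≤-antisym
      (injective-into-image⇒≤ (iso-injective ∘ representative-injective) representative-iso)
      (injective-into-image⇒≤ (iso-injective ∘ branch-injective) iso-branch-iso)

    vertex-count : p' + q' ≡ p + q
    vertex-count = +-cancelʳ-≡ 4 _ _
      (↔⇒≡ (↔-trans (↔-sym WV↔Fin) (↔-trans (branch-injective⇒↔ branch-injective) WV↔Fin)))

identity-model : {V : Set} {E : V → V → Set} → ContractionModel V E V E
identity-model = record
  { φ         = _≡_
  ; connected = λ v → (v , refl) , λ { _ _ refl refl → here refl }
  ; cover     = λ x → x , refl
  ; disjoint  = λ { _ _ _ refl refl → refl }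
  ; adjacency = λ u v _ → mk⇔ (λ uv → u , v , refl , refl , uv) λ { (_ , _ , refl , refl , uv) → uv }
  }

lemma12 : (p q p' q' : ℕ) → p ≥ 3 → q ≥ 3 → p' ≥ 3 → q' ≥ 3 →
          (HasContractionModelW p q p' q' ⇔ ((p ≡ p') × (q ≡ q')))
lemma12 p q p' q' p≥3 q≥3 _ q'≥3 = mk⇔
  (ContractionModelW.same-parameters (<⇒≤ p≥3) (<⇒≤ q≥3) (≤-trans (s≤s z≤n) q'≥3))
  λ { (refl , refl) → identity-model }
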